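{- Let $\mathbb{F}=\mathbb{F}_q$ be a finite field and let $p\in\mathbb{F}[x]$ be any polynomial. Then there exist $a,b\in\mathbb{F}$ such that the polynomial $p(x)+ax+b$ has no roots in $\mathbb{F}$.
   Context: $\mathbb{F}_q$ denotes the finite field with $q$ elements, $q$ a prime power. -}

module Defs where

open import Level using (Level; _⊔_; suc)
open import Algebra.Bundles using (CommutativeRing)
open import Data.Nat using (ℕ)
open import Data.Fin using (Fin)
open import Data.List using (List; []; _∷_)
open import Data.Product using (Σ; ∃; _×_)
open import Relation.Nullary using (¬_)
open import Relation.Binary.PropositionalEquality using (_≡_)

record IsField {c ℓ} (R : CommutativeRing c ℓ) : Set (c ⊔ ℓ) where
  open CommutativeRing R
  field
    1≉0     : ¬ (1# ≈ 0#)
    inverse : ∀ x → ¬ (x ≈ 0#) → ∃ λ y → (x * y) ≈ 1#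

record FiniteField c ℓ : Set (suc (c ⊔ ℓ)) where
  field
    commRing : CommutativeRing c ℓ
    isField : IsField commRing
  open CommutativeRing commRing
  field
    q          : ℕ
    enum       : Fin q → Carrier
    enum-surj  : ∀ x → ∃ λ i → enum i ≈ x
    enum-inj   : ∀ i j → enum i ≈ enum j → i ≡ j

-- Polynomials over a commutative ring, as coefficient lists
-- c₀ ∷ c₁ ∷ … ∷ cₙ representing c₀ + c₁ x + … + cₙ xⁿ.
module _ {c ℓ} (R : CommutativeRing c ℓ) where
  open CommutativeRing R

  Poly : Set c
  Poly = List Carrier

  eval : Poly → Carrier → Carrier
  eval []       x = 0#
  eval (a ∷ as) x = a + x * eval as x

  IsRoot : Poly → Carrier → Set ℓ
  IsRoot p r = eval p r ≈ 0#

  _+ₚ_ : Poly → Poly → Poly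
  []       +ₚ qs       = qs
  (a ∷ as) +ₚ []       = a ∷ as
  (a ∷ as) +ₚ (b ∷ bs) = (a + b) ∷ (as +ₚ bs)

{-# OPTIONS --safe #-}
-- Choose a so that G(x) = p(x) + a x takes the same value at 0 and 1, namely
-- a = p(0) - p(1).  A self-map of a finite set that is not injective is not
-- surjective, so G misses some value c, and then p(x) + a x - c has no root.
module Submission where

open import Defs
open import Data.Product using (∃₂)
open import Data.List using (_∷_; [])
open import Relation.Nullary using (¬_)

open import Algebra.Bundles using (CommutativeRing)
import Algebra.Properties.AbelianGroup as AbelianGroupProperties
import Algebra.Properties.CommutativeSemigroup as CommutativeSemigroupProperties
import Algebra.Properties.Group as GroupProperties
open import Data.Fin using (Fin; punchOut)
open import Data.Fin.Properties using (_≟_; any?; ¬∀⟶∃¬; punchOut-injective; injective⇒≤)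
open import Data.Nat using (ℕ; suc)
open import Data.Nat.Properties using (1+n≰n)
open import Data.Product using (∃; _,_; proj₁; proj₂; map; map₂)
open import Function.Definitions using (Injective)
open import Relation.Binary.Bundles using (Setoid)
open import Relation.Binary.PropositionalEquality as ≡ using (_≡_; _≢_; cong)
open import Relation.Nullary using (yes; no; contradiction)
import Relation.Binary.Reasoning.Setoid as SetoidReasoning

module FinEndo where

  open ≡ using (refl; sym; trans)

  injective⇒surjective : ∀ {n} {s : Fin n → Fin n} → Injective _≡_ _≡_ s →
                         ∀ i → ∃ λ d → s d ≡ i
  injective⇒surjective {suc n} {s} s-inj i with any? (λ d → s d ≟ i)
  ... | yes hit = hit
  ... | no miss = contradiction (injective⇒≤ punchOut∘s-injective) 1+n≰n
    where
    avoids : ∀ d → i ≢ s d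
    avoids d e = miss (d , sym e)
    punchOut∘s-injective : Injective _≡_ _≡_ (λ d → punchOut (avoids d))
    punchOut∘s-injective e = s-inj (punchOut-injective (avoids _) (avoids _) e)

  -- A section s of h is injective, hence surjective: i = s c and j = s d,
  -- and then c = h i = h j = d.
  surjective⇒injective : ∀ {n} {h : Fin n → Fin n} → (∀ c → ∃ λ k → h k ≡ c) →
                         Injective _≡_ _≡_ h
  surjective⇒injective {n} {h} h-surj {i} {j} hi≡hj = same-preimage hi≡hj (s-surj i) (s-surj j)
    where
    s : Fin n → Fin n
    s c = proj₁ (h-surj c)
    h∘s : ∀ c → h (s c) ≡ c
    h∘s c = proj₂ (h-surj c)
    s-surj : ∀ i → ∃ λ c → s c ≡ i
    s-surj = injective⇒surjective λ {c} {d} e → trans (sym (h∘s c)) (trans (cong h e) (h∘s d))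
    same-preimage : ∀ {i j} → h i ≡ h j → ∃ (λ c → s c ≡ i) → ∃ (λ d → s d ≡ j) → i ≡ j
    same-preimage hi≡hj (c , refl) (d , refl) = cong s (trans (sym (h∘s c)) (trans hi≡hj (h∘s d)))

  nonInjective⇒misses : ∀ {n} (h : Fin n → Fin n) {i j : Fin n} → i ≢ j → h i ≡ h j →
                        ∃ λ c → ∀ k → h k ≢ c
  nonInjective⇒misses {n} h i≢j hi≡hj =
    map₂ (λ unhit k hk≡c → unhit (k , hk≡c))
      (¬∀⟶∃¬ n _ (λ c → any? (λ k → h k ≟ c))
        (λ h-surj → i≢j (surjective⇒injective h-surj hi≡hj)))

module FiniteSetoid {a ℓ} (S : Setoid a ℓ) {q : ℕ}
  (enum : Fin q → Setoid.Carrier S)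
  (enum-surj : ∀ x → ∃ λ i → Setoid._≈_ S (enum i) x)
  (enum-inj : ∀ i j → Setoid._≈_ S (enum i) (enum j) → i ≡ j) where

  open Setoid S

  index : Carrier → Fin q
  index x = proj₁ (enum-surj x)

  enum-index : ∀ x → enum (index x) ≈ x
  enum-index x = proj₂ (enum-surj x)

  index-cong : ∀ {x y} → x ≈ y → index x ≡ index y
  index-cong {x} {y} x≈y = enum-inj _ _ (trans (enum-index x) (trans x≈y (sym (enum-index y))))

  index-enum : ∀ i → index (enum i) ≡ i
  index-enum i = enum-inj _ _ (enum-index (enum i))

  nonInjective⇒misses : (G : Carrier → Carrier) → (∀ {x y} → x ≈ y → G x ≈ G y) →
                        ∀ {x y} → ¬ x ≈ y → G x ≈ G y → ∃ λ c → ∀ z → ¬ G z ≈ c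
  nonInjective⇒misses G G-cong {x} {y} x≉y Gx≈Gy =
    map enum (λ unhit z Gz≈c → unhit (index z) (hits z Gz≈c))
      (FinEndo.nonInjective⇒misses h index-x≢index-y h-collides)
    where
    h : Fin q → Fin q
    h i = index (G (enum i))
    G-enum-index : ∀ z → G (enum (index z)) ≈ G z
    G-enum-index z = G-cong (enum-index z)
    index-x≢index-y : index x ≢ index y
    index-x≢index-y e = x≉y (trans (sym (enum-index x)) (trans (reflexive (cong enum e)) (enum-index y)))
    h-collides : h (index x) ≡ h (index y)
    h-collides = index-cong (trans (G-enum-index x) (trans Gx≈Gy (sym (G-enum-index y))))
    hits : ∀ z {c} → G z ≈ enum c → h (index z) ≡ c
    hits z Gz≈c = ≡.trans (index-cong (trans (G-enum-index z) Gz≈c)) (index-enum _)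

module Evaluation {c ℓ} (R : CommutativeRing c ℓ) where
  open CommutativeRing R
  open SetoidReasoning setoid
  open AbelianGroupProperties +-abelianGroup using (xyx⁻¹≈y)
  open GroupProperties +-group using (x∙y⁻¹≈ε⇒x≈y)
  open CommutativeSemigroupProperties +-commutativeSemigroup using (interchange; x∙yz≈xz∙y)

  eval-cong : ∀ p {x y} → x ≈ y → eval R p x ≈ eval R p y
  eval-cong []      x≈y = refl
  eval-cong (a ∷ p) x≈y = +-congˡ (*-cong x≈y (eval-cong p x≈y))

  eval-+ₚ : ∀ p r x → eval R (_+ₚ_ R p r) x ≈ eval R p x + eval R r x
  eval-+ₚ []      r       x = sym (+-identityˡ _)
  eval-+ₚ (a ∷ p) []      x = sym (+-identityʳ _)
  eval-+ₚ (a ∷ p) (b ∷ r) x =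
    trans (+-congˡ (trans (*-congˡ (eval-+ₚ p r x)) (distribˡ x _ _)))
          (interchange a b _ _)

  eval-linear : ∀ b a x → eval R (b ∷ a ∷ []) x ≈ b + x * a
  eval-linear b a x = +-congˡ (*-congˡ (trans (+-congˡ (zeroʳ x)) (+-identityʳ a)))

  tilted : Poly R → Carrier → Carrier → Carrier
  tilted p a x = eval R p x + x * a

  tilted-cong : ∀ p a {x y} → x ≈ y → tilted p a x ≈ tilted p a y
  tilted-cong p a x≈y = +-cong (eval-cong p x≈y) (*-congʳ x≈y)

  tilted-0≈tilted-1 : ∀ p → let a = eval R p 0# - eval R p 1# in tilted p a 0# ≈ tilted p a 1#
  tilted-0≈tilted-1 p = begin
    eval R p 0# + 0# * a  ≈⟨ trans (+-congˡ (zeroˡ a)) (+-identityʳ _) ⟩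
    eval R p 0#           ≈⟨ trans (sym (+-assoc _ _ _)) (xyx⁻¹≈y _ _) ⟨
    eval R p 1# + a       ≈⟨ +-congˡ (*-identityˡ a) ⟨
    eval R p 1# + 1# * a  ∎
    where
    a = eval R p 0# - eval R p 1#

  root⇒tilted≈ : ∀ p a c x → IsRoot R (_+ₚ_ R p (- c ∷ a ∷ [])) x → tilted p a x ≈ c
  root⇒tilted≈ p a c x root = x∙y⁻¹≈ε⇒x≈y _ c (begin
    tilted p a x - c                         ≈⟨ x∙yz≈xz∙y _ _ _ ⟨
    eval R p x + (- c + x * a)               ≈⟨ +-congˡ (eval-linear (- c) a x) ⟨
    eval R p x + eval R (- c ∷ a ∷ []) x     ≈⟨ eval-+ₚ p _ x ⟨
    eval R (_+ₚ_ R p (- c ∷ a ∷ [])) x       ≈⟨ root ⟩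
    0#                                       ∎)

mainTheorem1 : ∀ {c ℓ} (F : FiniteField c ℓ) →
    let R = FiniteField.commRing F in
    (p : Poly R) →
    ∃₂ λ a b → ∀ x → ¬ IsRoot R (_+ₚ_ R p (b ∷ a ∷ [])) x
mainTheorem1 F p = a , - c , λ x root → tilted≉c x (root⇒tilted≈ p a c x root)
  where
  open FiniteField F
  open CommutativeRing commRing
  open FiniteSetoid setoid enum enum-surj enum-inj using (nonInjective⇒misses)
  open Evaluation commRing

  a : Carrier
  a = eval commRing p 0# - eval commRing p 1#

  0≉1 : ¬ 0# ≈ 1#
  0≉1 0≈1 = IsField.1≉0 isField (sym 0≈1)

  missed : ∃ λ c → ∀ x → ¬ tilted p a x ≈ c
  missed = nonInjective⇒misses (tilted p a) (tilted-cong p a) 0≉1 (tilted-0≈tilted-1 p)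

  c : Carrier
  c = proj₁ missed

  tilted≉c : ∀ x → ¬ tilted p a x ≈ c
  tilted≉c = proj₂ missed
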